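{- Let $G$ be a graph with $\chi(G)>3$, let $D$ be any drawing of $G$ in the plane in which no three edges cross at a common point, and let $G'$ be the planar graph obtained from $G$ and $D$ by the crossover-gadget construction described below. If $W(G)>4k$ for an integer $k$, then $W(G')>k$.
   Context: Graphs are finite and simple; $\chi$ is the chromatic number, $K_3$ the complete graph on 3 vertices. For $G$ with $\chi(G)>3$, $W(G)$ is the minimum $k$ such that some existential-positive first-order sentence (built from adjacency and equality atoms using only conjunction, disjunction and existential quantification) with at most $k$ distinct variables is true on $G$ and false on $K_3$. The crossover gadget $C$ is the 13-vertex graph with vertices $a_{0,0},a_{\pm1,0},a_{\pm2,0},a_{0,\pm1},a_{\pm1,\pm1},a_{0,\pm2}$ and edges $a_{0,0}a_{1,0}$, $a_{1,0}a_{2,0}$, $a_{0,0}a_{ -1,0}$, $a_{ -1,0}a_{ -2,0}$; $a_{0,1}$ adjacent to $a_{ -1,0},a_{0,0},a_{1,0}$; $a_{0,-1}$ adjacent to $a_{ -1,0},a_{0,0},a_{1,0}$; $a_{1,1}$ adjacent to $a_{1,0},a_{2,0}$; $a_{ -1,1}$ adjacent to $a_{0,1},a_{ -2,0}$; $a_{1,-1}$ adjacent to $a_{0,-1},a_{2,0}$; $a_{ -1,-1}$ adjacent to $a_{ -1,0},a_{ -2,0}$; $a_{0,2}$ adjacent to $a_{ -1,1},a_{0,1},a_{1,1}$; $a_{0,-2}$ adjacent to $a_{ -1,-1},a_{0,-1},a_{1,-1}$. Its corners are $a_{ -2,0},a_{2,0}$ (one opposite pair) and $a_{0,2},a_{0,-2}$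 (the other opposite pair); in every proper 3-coloring of $C$ opposite corners get equal colors, and every coloring of the corners in which opposite corners are equal extends uniquely to a proper 3-coloring of $C$. Construction of $G'$: each crossing point of two edges $uv$ and $wz$ in $D$ is replaced by a fresh copy of $C$, placed so that one opposite pair of corners lies along $uv$ and the other along $wz$. For an edge $uv$ crossed at points $p_1,\dots,p_t$ ($t\ge1$) in order from $u$ to $v$, the edge $uv$ is removed; the corner of the gadget at $p_1$ facing $u$ is identified with $u$, for each $i<t$ the corner of the gadget at $p_i$ facing $v$ is identified with the corner of the gadget at $p_{i+1}$ facing $u$, and the corner of the gadget at $p_t$ facing $v$ is joined to $v$ by an edge. Edges without crossings are kept. The result $G'$ is planar, contains $V(G)$, and $\chi(G')>3$ whenever $\chi(G)>3$. -}

module Defs where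

open import Data.Nat using (ℕ)
open import Data.Fin using (Fin; _≟_)
open import Data.Bool using (Bool; true; false; if_then_else_)
open import Data.List using (List; []; _∷_; _++_)
open import Data.List.Membership.Propositional using (_∈_)
open import Data.List.Relation.Unary.Unique.Propositional using (Unique)
open import Data.Product using (Σ; _×_; _,_; proj₁; proj₂)
open import Data.Sum using (_⊎_; inj₁; inj₂)
open import Relation.Nullary using (¬_; does)
open import Relation.Binary.PropositionalEquality using (_≡_; _≢_)

record Str : Set₁ where
  field
    V : Set
    E : V → V → Set
open Str public

-- Each edge e has endpoints (src e , tgt e); the orientation only fixes
-- which end plays the role of "u" and which "v" in the construction.

record Graph : Set where
  field
    n     : ℕ
    m     : ℕ
    src   : Fin m → Fin n
    tgt   : Fin m → Fin n
    loopless : ∀ e → src e ≢ tgt e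
    no-parallel : ∀ e e' →
      ((src e ≡ src e' × tgt e ≡ tgt e') ⊎ (src e ≡ tgt e' × tgt e ≡ src e'))
      → e ≡ e'

  Adj : Fin n → Fin n → Set
  Adj x y = Σ (Fin m) λ e → (src e ≡ x × tgt e ≡ y) ⊎ (src e ≡ y × tgt e ≡ x)

open Graph public

toStr : Graph → Str
toStr G = record { V = Fin (n G) ; E = Adj G }

ChiGt3 : Graph → Set
ChiGt3 G = ¬ Σ (Fin (n G) → Fin 3) λ col →
             ∀ x y → Adj G x y → col x ≢ col y

K3 : Str
K3 = record { V = Fin 3 ; E = λ x y → x ≢ y }

data Formula (k : ℕ) : Set where
  adj  : Fin k → Fin k → Formula k
  eq   : Fin k → Fin k → Formula k
  _∧_  : Formula k → Formula k → Formula k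
  _∨_  : Formula k → Formula k → Formula k
  ex   : Fin k → Formula k → Formula k

Free : ∀ {k} → Fin k → Formula k → Set
Free i (adj x y) = i ≡ x ⊎ i ≡ y
Free i (eq x y)  = i ≡ x ⊎ i ≡ y
Free i (φ ∧ ψ)   = Free i φ ⊎ Free i ψ
Free i (φ ∨ ψ)   = Free i φ ⊎ Free i ψ
Free i (ex j φ)  = i ≢ j × Free i φ

Sentence : ∀ {k} → Formula k → Set
Sentence φ = ∀ i → ¬ Free i φ

update : ∀ {k} {A : Set} → (Fin k → A) → Fin k → A → Fin k → A
update ρ i a j = if does (j ≟ i) then a else ρ j

⟦_⟧ : ∀ {k} → Formula k → (S : Str) → (Fin k → V S) → Set
⟦ adj x y ⟧ S ρ = E S (ρ x) (ρ y)
⟦ eq x y ⟧  S ρ = ρ x ≡ ρ y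
⟦ φ ∧ ψ ⟧   S ρ = ⟦ φ ⟧ S ρ × ⟦ ψ ⟧ S ρ
⟦ φ ∨ ψ ⟧   S ρ = ⟦ φ ⟧ S ρ ⊎ ⟦ ψ ⟧ S ρ
⟦ ex i φ ⟧  S ρ = Σ (V S) λ a → ⟦ φ ⟧ S (update ρ i a)

-- truth of a sentence (its value does not depend on the assignment;
-- the existential also makes every sentence false on an empty structure)
_⊨_ : ∀ {k} → Str → Formula k → Set
S ⊨ φ = Σ (Fin _ → V S) λ ρ → ⟦ φ ⟧ S ρ

-- W(S) > w : no existential-positive sentence with at most w distinct
-- variables is true on S and false on K₃.
WGt : Str → ℕ → Set
WGt S w = (φ : Formula w) → Sentence φ → S ⊨ φ → K3 ⊨ φ

data CV : Set where
  a[0,0] a[1,0] a[2,0] a[-1,0] a[-2,0] a[0,1] a[0,-1]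
    a[1,1] a[-1,1] a[1,-1] a[-1,-1] a[0,2] a[0,-2] : CV

data CEdge : CV → CV → Set where
  c1  : CEdge a[0,0] a[1,0]
  c2  : CEdge a[1,0] a[2,0]
  c3  : CEdge a[0,0] a[-1,0]
  c4  : CEdge a[-1,0] a[-2,0]
  c5  : CEdge a[0,1] a[-1,0]
  c6  : CEdge a[0,1] a[0,0]
  c7  : CEdge a[0,1] a[1,0]
  c8  : CEdge a[0,-1] a[-1,0]
  c9  : CEdge a[0,-1] a[0,0]
  c10 : CEdge a[0,-1] a[1,0]
  c11 : CEdge a[1,1] a[1,0]
  c12 : CEdge a[1,1] a[2,0]
  c13 : CEdge a[-1,1] a[0,1]
  c14 : CEdge a[-1,1] a[-2,0]
  c15 : CEdge a[1,-1] a[0,-1]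
  c16 : CEdge a[1,-1] a[2,0]
  c17 : CEdge a[-1,-1] a[-1,0]
  c18 : CEdge a[-1,-1] a[-2,0]
  c19 : CEdge a[0,2] a[-1,1]
  c20 : CEdge a[0,2] a[0,1]
  c21 : CEdge a[0,2] a[1,1]
  c22 : CEdge a[0,-2] a[-1,-1]
  c23 : CEdge a[0,-2] a[0,-1]
  c24 : CEdge a[0,-2] a[1,-1]

-- Combinatorial data of a drawing D of G in which no three edges cross
-- at a common point: finitely many crossing points, each a crossing of
-- exactly two distinct edges, the order of the crossings along every edge
-- (from src to tgt), and the placement of the gadget at each crossing.

record Drawing (G : Graph) : Set where
  field
    c      : ℕ
    e₁ e₂  : Fin c → Fin (m G)
    e₁≢e₂  : ∀ p → e₁ p ≢ e₂ p
    along  : Fin (m G) → List (Fin c) -- crossings on e, in order src → tgt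
    along-unique : ∀ e → Unique (along e)
    along-sound  : ∀ e p → p ∈ along e → (e ≡ e₁ p ⊎ e ≡ e₂ p)
    along-complete : ∀ e p → (e ≡ e₁ p ⊎ e ≡ e₂ p) → p ∈ along e
    -- placement of the gadget at p: corners a[±2,0] lie along e₁ p,
    -- corners a[0,±2] along e₂ p.  flip₁ p = false: a[-2,0] faces src (e₁ p);
    -- flip₂ p = false: a[0,-2] faces src (e₂ p).
    flip₁ flip₂ : Fin c → Bool

module Construction (G : Graph) (D : Drawing G) where
  open Drawing D

  SrcCorner : Fin c → Fin (m G) → CV → Set
  SrcCorner p e x =
      (e ≡ e₁ p × x ≡ (if flip₁ p then a[2,0] else a[-2,0]))
    ⊎ (e ≡ e₂ p × x ≡ (if flip₂ p then a[0,2] else a[0,-2]))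

  TgtCorner : Fin c → Fin (m G) → CV → Set
  TgtCorner p e x =
      (e ≡ e₁ p × x ≡ (if flip₁ p then a[-2,0] else a[2,0]))
    ⊎ (e ≡ e₂ p × x ≡ (if flip₂ p then a[0,-2] else a[0,2]))

  -- vertices before identification: V(G) plus a fresh copy of C per crossing
  V₀ : Set
  V₀ = Fin (n G) ⊎ (Fin c × CV)

  -- Ident a b : vertex a is identified with (replaced by) vertex b
  data Ident : V₀ → V₀ → Set where
    first : ∀ e p ys x → along e ≡ p ∷ ys → SrcCorner p e x →
            Ident (inj₂ (p , x)) (inj₁ (src G e))
    next  : ∀ e xs p q ys x y → along e ≡ xs ++ p ∷ q ∷ ys →
            TgtCorner p e y → SrcCorner q e x →
            Ident (inj₂ (q , x)) (inj₂ (p , y))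

  Dead : V₀ → Set
  Dead a = Σ V₀ λ b → Ident a b

  -- the vertex of G' that a ∈ V₀ becomes
  Canon : V₀ → V₀ → Set
  Canon a b = (¬ Dead a × a ≡ b) ⊎ Ident a b

  data BaseE : V₀ → V₀ → Set where
    gadget : ∀ p x y → CEdge x y → BaseE (inj₂ (p , x)) (inj₂ (p , y))
    keep   : ∀ e → along e ≡ [] → BaseE (inj₁ (src G e)) (inj₁ (tgt G e))
    last   : ∀ e xs p y → along e ≡ xs ++ p ∷ [] → TgtCorner p e y →
             BaseE (inj₂ (p , y)) (inj₁ (tgt G e))

  V' : Set
  V' = Σ V₀ λ a → ¬ Dead a

  E' : V' → V' → Set
  E' x y = Σ V₀ λ a → Σ V₀ λ b → BaseE a b ×
           ((Canon a (proj₁ x) × Canon b (proj₁ y))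
          ⊎ (Canon b (proj₁ x) × Canon a (proj₁ y)))

  G' : Str
  G' = record { V = V' ; E = E' }

G'-of : (G : Graph) → Drawing G → Str
G'-of G D = Construction.G' G D

-- Each vertex of G' is encoded by a 4-tuple of vertices of G: a vertex u of G by (u, u, u, u), a
-- vertex of the gadget at a crossing by the endpoints of the two crossing edges. A K₃-colouring of
-- such a tuple decodes to a colour of the vertex: the colour of u, resp. the proper colouring of the
-- gadget whose corners along each edge get the colour of that edge's source. Whenever the colourings
-- of the encodings of two adjacent vertices of G' respect equality and adjacency between the two
-- tuples, the decoded colours differ. So a k-variable existential-positive sentence true in G'
-- translates into a 4k-variable one true in G: every variable becomes a block of four, every ∃
-- becomes a disjunction over the finitely many vertices of G' followed by four quantifiers, and every
-- atom becomes the atomic diagram of the two encodings when the atom is forced by it (false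
-- otherwise). A K₃-model of the translation then decodes to a K₃-model of the sentence.

module Submission where

open import Defs
open import Data.Bool using (true; false; if_then_else_)
open import Data.Nat using (ℕ; zero; suc; _*_)
open import Data.Fin using (Fin; zero; suc; combine; quotient; remainder; punchOut; _≟_)
open import Data.Fin.Patterns using (0F; 1F; 2F)
open import Data.Fin.Properties
  using (all?; any?; remQuot-combine; combine-remQuot; combine-injectiveʳ; punchIn-punchOut)
open import Data.List using (List; []; _∷_; _++_; map; allFin; cartesianProduct)
open import Data.List.Membership.Propositional using (_∈_)
open import Data.List.Membership.Propositional.Properties
  using (∈-allFin; ∈-map⁺; ∈-++⁺ˡ; ∈-++⁺ʳ; ∈-cartesianProduct⁺)
open import Data.List.Relation.Unary.Any using (here; there)
open import Data.Product using (Σ-syntax; _×_; _,_; proj₁; proj₂)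
open import Data.Sum using (_⊎_; inj₁; inj₂; [_,_])
import Data.Sum as Sum
open import Data.Empty using (⊥-elim)
import Data.Vec.Functional as Vector
open import Function using (_∘_)
open import Data.Fin.Permutation using (Permutation′; _⟨$⟩ʳ_; _⟨$⟩ˡ_; inverseˡ; insert; transpose; id)
open import Relation.Binary using (DecidableEquality; Decidable; Symmetric)
open import Relation.Nullary using (Dec; yes; no; ¬_)
open import Relation.Nullary.Decidable using (map′; _×-dec_; _⊎-dec_; _→-dec_; ¬?)
open import Relation.Binary.PropositionalEquality
  using (_≡_; _≢_; refl; sym; trans; cong; cong₂; subst; subst₂; _≗_)

module _ {k : ℕ} {A : Set} where

  update-cong : {ρ ρ′ : Fin k → A} (i : Fin k) (a : A) → ρ ≗ ρ′ → update ρ i a ≗ update ρ′ i a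
  update-cong i a ρ≗ρ′ j with j ≟ i
  ... | yes _ = refl
  ... | no  _ = ρ≗ρ′ j

  update-other : (ρ : Fin k → A) {i j : Fin k} (a : A) → j ≢ i → update ρ i a j ≡ ρ j
  update-other ρ {i} {j} a j≢i with j ≟ i
  ... | yes j≡i = ⊥-elim (j≢i j≡i)
  ... | no  _   = refl

  update-natural : ∀ {B : Set} (f : B → A) {τ : Fin k → A} {ρ : Fin k → B} (i : Fin k) (b : B) →
                   (∀ j → τ j ≡ f (ρ j)) → ∀ j → update τ i (f b) j ≡ f (update ρ i b j)
  update-natural f i b τ≗fρ j with j ≟ i
  ... | yes _ = refl
  ... | no  _ = τ≗fρ j

both-branches : ∀ {A : Set} (P : A → Set) b {x y} → P x → P y → P (if b then x else y)
both-branches P true  px _  = px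
both-branches P false _  py = py

if-swap-≢ : ∀ {A : Set} b {x y : A} → x ≢ y → (if b then x else y) ≢ (if b then y else x)
if-swap-≢ true  x≢y = x≢y
if-swap-≢ false x≢y = x≢y ∘ sym

⟦⟧-cong : ∀ {k} (φ : Formula k) (S : Str) {ρ ρ′ : Fin k → V S} →
          ρ ≗ ρ′ → ⟦ φ ⟧ S ρ → ⟦ φ ⟧ S ρ′
⟦⟧-cong (adj x y) S ρ≗ρ′ h       = subst₂ (E S) (ρ≗ρ′ x) (ρ≗ρ′ y) h
⟦⟧-cong (eq x y)  S ρ≗ρ′ h       = trans (sym (ρ≗ρ′ x)) (trans h (ρ≗ρ′ y))
⟦⟧-cong (φ ∧ ψ)   S ρ≗ρ′ (h , h′) = ⟦⟧-cong φ S ρ≗ρ′ h , ⟦⟧-cong ψ S ρ≗ρ′ h′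
⟦⟧-cong (φ ∨ ψ)   S ρ≗ρ′ h       = Sum.map (⟦⟧-cong φ S ρ≗ρ′) (⟦⟧-cong ψ S ρ≗ρ′) h
⟦⟧-cong (ex i φ)  S ρ≗ρ′ (a , h) = a , ⟦⟧-cong φ S (update-cong i a ρ≗ρ′) h

no-formula₀ : ¬ Formula 0
no-formula₀ (adj () _)
no-formula₀ (eq () _)
no-formula₀ (φ ∧ _) = no-formula₀ φ
no-formula₀ (φ ∨ _) = no-formula₀ φ
no-formula₀ (ex () _)

module _ {K : ℕ} where

  exAll : ∀ {n} → (Fin n → Fin K) → Formula K → Formula K
  exAll {zero}  xs ψ = ψ
  exAll {suc n} xs ψ = ex (xs zero) (exAll (xs ∘ suc) ψ)

  Outside : ∀ {n} → (Fin n → Fin K) → Fin K → Set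
  Outside xs x = ∀ t → x ≢ xs t

  exAll-intro : ∀ {n} (xs : Fin n → Fin K) (ψ : Formula K) (S : Str) {ρ ρ′ : Fin K → V S} →
                (∀ x → Outside xs x → ρ′ x ≡ ρ x) → ⟦ ψ ⟧ S ρ′ → ⟦ exAll xs ψ ⟧ S ρ
  exAll-intro {zero}  xs ψ S agree h = ⟦⟧-cong ψ S (λ x → agree x (λ ())) h
  exAll-intro {suc n} xs ψ S {ρ} {ρ′} agree h = ρ′ (xs zero) , exAll-intro (xs ∘ suc) ψ S agree′ h
    where
    agree′ : ∀ x → Outside (xs ∘ suc) x → ρ′ x ≡ update ρ (xs zero) (ρ′ (xs zero)) x
    agree′ x out with x ≟ xs zero
    ... | yes refl = refl
    ... | no  x≢x₀ = agree x λ { zero → x≢x₀ ; (suc t) → out t }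

  exAll-elim : ∀ {n} (xs : Fin n → Fin K) (ψ : Formula K) (S : Str) {ρ : Fin K → V S} →
               ⟦ exAll xs ψ ⟧ S ρ →
               Σ[ ρ′ ∈ (Fin K → V S) ] (∀ x → Outside xs x → ρ′ x ≡ ρ x) × ⟦ ψ ⟧ S ρ′
  exAll-elim {zero}  xs ψ S {ρ} h = ρ , (λ _ _ → refl) , h
  exAll-elim {suc n} xs ψ S {ρ} (a , h) with exAll-elim (xs ∘ suc) ψ S h
  ... | ρ′ , agree , h′ =
    ρ′ , (λ x out → trans (agree x (out ∘ suc)) (update-other ρ a (out zero))) , h′

  exAll-free : ∀ {n} (xs : Fin n → Fin K) (ψ : Formula K) {w : Fin K} →
               Free w (exAll xs ψ) → Outside xs w × Free w ψ
  exAll-free {zero}  xs ψ h = (λ ()) , h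
  exAll-free {suc n} xs ψ (w≢x₀ , h) with exAll-free (xs ∘ suc) ψ h
  ... | out , h′ = (λ { zero → w≢x₀ ; (suc t) → out t }) , h′

-- Formula has no constants: TRUE and FALSE are closed sentences on the variable v₀.
module Connectives {K : ℕ} (v₀ : Fin K) where

  TRUE FALSE : Formula K
  TRUE  = ex v₀ (eq v₀ v₀)
  FALSE = ex v₀ (adj v₀ v₀)

  TRUE-holds : ∀ (S : Str) {ρ} → ⟦ TRUE ⟧ S ρ
  TRUE-holds S {ρ} = ρ v₀ , refl

  FALSE-K3 : ∀ {σ} → ¬ ⟦ FALSE ⟧ K3 σ
  FALSE-K3 (_ , c≢c) = c≢c refl

  TRUE-closed : ∀ {w} → ¬ Free w TRUE
  TRUE-closed (w≢v₀ , inj₁ w≡v₀) = w≢v₀ w≡v₀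
  TRUE-closed (w≢v₀ , inj₂ w≡v₀) = w≢v₀ w≡v₀

  FALSE-closed : ∀ {w} → ¬ Free w FALSE
  FALSE-closed (w≢v₀ , inj₁ w≡v₀) = w≢v₀ w≡v₀
  FALSE-closed (w≢v₀ , inj₂ w≡v₀) = w≢v₀ w≡v₀

  module _ {X : Set} where

    ⋀ ⋁ : List X → (X → Formula K) → Formula K
    ⋀ []       f = TRUE
    ⋀ (x ∷ xs) f = f x ∧ ⋀ xs f
    ⋁ []       f = FALSE
    ⋁ (x ∷ xs) f = f x ∨ ⋁ xs f

    ⋀-intro : ∀ xs {f} (S : Str) {ρ} → (∀ x → ⟦ f x ⟧ S ρ) → ⟦ ⋀ xs f ⟧ S ρ
    ⋀-intro []       S {ρ} h = TRUE-holds S {ρ}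
    ⋀-intro (x ∷ xs) S h = h x , ⋀-intro xs S h

    ⋀-elim : ∀ {xs f} (S : Str) {ρ x} → ⟦ ⋀ xs f ⟧ S ρ → x ∈ xs → ⟦ f x ⟧ S ρ
    ⋀-elim S (h , _) (here refl) = h
    ⋀-elim S (_ , h) (there x∈xs) = ⋀-elim S h x∈xs

    ⋀-free : ∀ xs {f w} → Free w (⋀ xs f) → Σ[ x ∈ X ] Free w (f x)
    ⋀-free []       h        = ⊥-elim (TRUE-closed h)
    ⋀-free (x ∷ xs) (inj₁ h) = x , h
    ⋀-free (x ∷ xs) (inj₂ h) = ⋀-free xs h

    ⋁-intro : ∀ {xs f} (S : Str) {ρ x} → x ∈ xs → ⟦ f x ⟧ S ρ → ⟦ ⋁ xs f ⟧ S ρ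
    ⋁-intro S (here refl)  h = inj₁ h
    ⋁-intro S (there x∈xs) h = inj₂ (⋁-intro S x∈xs h)

    ⋁-elim : ∀ xs {f σ} → ⟦ ⋁ xs f ⟧ K3 σ → Σ[ x ∈ X ] ⟦ f x ⟧ K3 σ
    ⋁-elim []       {σ = σ} h = ⊥-elim (FALSE-K3 {σ} h)
    ⋁-elim (x ∷ xs) (inj₁ h) = x , h
    ⋁-elim (x ∷ xs) (inj₂ h) = ⋁-elim xs h

    ⋁-free : ∀ xs {f w} → Free w (⋁ xs f) → Σ[ x ∈ X ] Free w (f x)
    ⋁-free []       h        = ⊥-elim (FALSE-closed h)
    ⋁-free (x ∷ xs) (inj₁ h) = x , h
    ⋁-free (x ∷ xs) (inj₂ h) = ⋁-free xs h

  module _ {P : Set} where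

    _⇒ᶠ_ _∧ᶠ_ : Dec P → Formula K → Formula K
    yes _ ⇒ᶠ φ = φ
    no  _ ⇒ᶠ φ = TRUE
    yes _ ∧ᶠ φ = φ
    no  _ ∧ᶠ φ = FALSE

    ⇒ᶠ-intro : ∀ (P? : Dec P) {φ} (S : Str) {ρ} → (P → ⟦ φ ⟧ S ρ) → ⟦ P? ⇒ᶠ φ ⟧ S ρ
    ⇒ᶠ-intro (yes p) S h = h p
    ⇒ᶠ-intro (no  _) S {ρ} h = TRUE-holds S {ρ}

    ⇒ᶠ-elim : ∀ (P? : Dec P) {φ} (S : Str) {ρ} → ⟦ P? ⇒ᶠ φ ⟧ S ρ → P → ⟦ φ ⟧ S ρ
    ⇒ᶠ-elim (yes _) S h _ = h
    ⇒ᶠ-elim (no ¬p) S h p = ⊥-elim (¬p p)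

    ⇒ᶠ-free : ∀ (P? : Dec P) {φ w} → Free w (P? ⇒ᶠ φ) → Free w φ
    ⇒ᶠ-free (yes _) h = h
    ⇒ᶠ-free (no  _) h = ⊥-elim (TRUE-closed h)

    ∧ᶠ-intro : ∀ (P? : Dec P) {φ} (S : Str) {ρ} → P → ⟦ φ ⟧ S ρ → ⟦ P? ∧ᶠ φ ⟧ S ρ
    ∧ᶠ-intro (yes _) S _ h = h
    ∧ᶠ-intro (no ¬p) S p _ = ⊥-elim (¬p p)

    ∧ᶠ-elim : ∀ (P? : Dec P) {φ σ} → ⟦ P? ∧ᶠ φ ⟧ K3 σ → P × ⟦ φ ⟧ K3 σ
    ∧ᶠ-elim (yes p) h = p , h
    ∧ᶠ-elim (no  _) {σ = σ} h = ⊥-elim (FALSE-K3 {σ} h)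

    ∧ᶠ-free : ∀ (P? : Dec P) {φ w} → Free w (P? ∧ᶠ φ) → Free w φ
    ∧ᶠ-free (yes _) h = h
    ∧ᶠ-free (no  _) h = ⊥-elim (FALSE-closed h)

record IsCrossHom (S : Str) {m n : ℕ} (u : Fin m → V S) (w : Fin n → V S)
                  (s : Fin m → Fin 3) (t : Fin n → Fin 3) : Set where
  field
    consistent : ∀ p q → u p ≡ w q → s p ≡ t q
    separating : ∀ p q → E S (u p) (w q) → s p ≢ t q
open IsCrossHom public

module _ {S : Str} {m n : ℕ} {u : Fin m → V S} {w : Fin n → V S} where

  IsCrossHom-sym : Symmetric (E S) → ∀ {s t} → IsCrossHom S u w s t → IsCrossHom S w u t s
  IsCrossHom-sym E-sym h = record
    { consistent = λ q p e → sym (consistent h p q (sym e))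
    ; separating = λ q p a c → separating h p q (E-sym a) (sym c)
    }

  IsCrossHom-cong : ∀ {s s′ t t′} → s ≗ s′ → t ≗ t′ →
                    IsCrossHom S u w s t → IsCrossHom S u w s′ t′
  IsCrossHom-cong s≗s′ t≗t′ h = record
    { consistent = λ p q e → trans (sym (s≗s′ p)) (trans (consistent h p q e) (t≗t′ q))
    ; separating = λ p q a c → separating h p q a (trans (s≗s′ p) (trans c (sym (t≗t′ q))))
    }

  isCrossHom? : DecidableEquality (V S) → Decidable (E S) → ∀ s t → Dec (IsCrossHom S u w s t)
  isCrossHom? _≟ₛ_ E? s t =
    map′ (λ (c , r) → record { consistent = c ; separating = r })
         (λ h → consistent h , separating h)
         ((all? λ p → all? λ q → (u p ≟ₛ w q) →-dec (s p ≟ t q))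
           ×-dec (all? λ p → all? λ q → E? (u p) (w q) →-dec ¬? (s p ≟ t q)))

∀-functions? : ∀ n {m} {P : (Fin n → Fin m) → Set} →
               (∀ {s s′} → s ≗ s′ → P s → P s′) → (∀ s → Dec (P s)) → Dec (∀ s → P s)
∀-functions? zero    resp P? = map′ (λ p s → resp (λ ()) p) (λ h → h Vector.[]) (P? Vector.[])
∀-functions? (suc n) resp P? =
  map′ (λ h s → resp (λ { zero → refl ; (suc _) → refl }) (h (s zero) (s ∘ suc)))
       (λ h c s → h (c Vector.∷ s))
       (all? λ c → ∀-functions? n (λ s≗s′ → resp λ { zero → refl ; (suc i) → s≗s′ i })
                                  (λ s → P? (c Vector.∷ s)))

module Diagrams {S : Str} (_≟ₛ_ : DecidableEquality (V S)) (E? : Decidable (E S))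
                {K : ℕ} (v₀ : Fin K) where
  open Connectives v₀


  atom : V S → V S → Fin K → Fin K → Formula K
  atom x y vx vy = (E? x y ⇒ᶠ adj vx vy) ∧ ((x ≟ₛ y) ⇒ᶠ eq vx vy)

  crossDiagram : ∀ {m n} → (Fin m → V S) → (Fin n → V S) →
                 (Fin m → Fin K) → (Fin n → Fin K) → Formula K
  crossDiagram {m} {n} u w vu vw = ⋀ (allFin m) λ p → ⋀ (allFin n) λ q → atom (u p) (w q) (vu p) (vw q)

  module _ {m n} (u : Fin m → V S) (w : Fin n → V S) (vu : Fin m → Fin K) (vw : Fin n → Fin K) where

    crossDiagram-holds : ∀ {ρ} → (∀ p → ρ (vu p) ≡ u p) → (∀ q → ρ (vw q) ≡ w q) →
                         ⟦ crossDiagram u w vu vw ⟧ S ρ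
    crossDiagram-holds ρvu ρvw =
      ⋀-intro (allFin m) S λ p → ⋀-intro (allFin n) S λ q →
        ⇒ᶠ-intro (E? (u p) (w q)) S (subst₂ (E S) (sym (ρvu p)) (sym (ρvw q))) ,
        ⇒ᶠ-intro (u p ≟ₛ w q) S (λ e → trans (ρvu p) (trans e (sym (ρvw q))))

    crossDiagram-K3 : ∀ {σ} → ⟦ crossDiagram u w vu vw ⟧ K3 σ → IsCrossHom S u w (σ ∘ vu) (σ ∘ vw)
    crossDiagram-K3 h = record
      { consistent = λ p q → ⇒ᶠ-elim (u p ≟ₛ w q) K3 (proj₂ (atom-at p q))
      ; separating = λ p q → ⇒ᶠ-elim (E? (u p) (w q)) K3 (proj₁ (atom-at p q))
      }
      where
      atom-at = λ p q → ⋀-elim K3 (⋀-elim K3 h (∈-allFin p)) (∈-allFin q)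

    crossDiagram-free : ∀ {x} → Free x (crossDiagram u w vu vw) →
                        (Σ[ p ∈ Fin m ] x ≡ vu p) ⊎ (Σ[ q ∈ Fin n ] x ≡ vw q)
    crossDiagram-free h with ⋀-free (allFin m) h
    ... | p , h′ with ⋀-free (allFin n) h′
    ...   | q , inj₁ h″ with ⇒ᶠ-free (E? (u p) (w q)) h″
    ...     | inj₁ x≡ = inj₁ (p , x≡)
    ...     | inj₂ x≡ = inj₂ (q , x≡)
    crossDiagram-free h | p , h′ | q , inj₂ h″ with ⇒ᶠ-free (u p ≟ₛ w q) h″
    ...     | inj₁ x≡ = inj₁ (p , x≡)
    ...     | inj₂ x≡ = inj₂ (q , x≡)

module Forcing (S : Str) {A : Set} {n : ℕ}
               (enc : A → Fin n → V S) (dec : A → (Fin n → Fin 3) → Fin 3) where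

  Forced : (Fin 3 → Fin 3 → Set) → A → A → Set
  Forced R a b = ∀ s t → IsCrossHom S (enc a) (enc b) s t → R (dec a s) (dec b t)

  ForcedApart ForcedEqual : A → A → Set
  ForcedApart = Forced _≢_
  ForcedEqual = Forced _≡_

  forcedApart-sym : Symmetric (E S) → ∀ {a b} → ForcedApart a b → ForcedApart b a
  forcedApart-sym E-sym apart s t h c = apart t s (IsCrossHom-sym E-sym h) (sym c)

  module _ (dec-cong : ∀ a {s s′} → s ≗ s′ → dec a s ≡ dec a s′) where

    forcedEqual-refl : ∀ a → ForcedEqual a a
    forcedEqual-refl a s t h = dec-cong a (λ p → consistent h p p refl)

    -- forced? enumerates all pairs of colourings; it must never be unfolded during type checking.
    opaque
      forced? : DecidableEquality (V S) → Decidable (E S) →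
                ∀ {R} → Decidable R → ∀ a b → Dec (Forced R a b)
      forced? _≟ₛ_ E? {R} R? a b =
        ∀-functions? n respˢ λ s → ∀-functions? n (respᵗ s) λ t →
          isCrossHom? _≟ₛ_ E? s t →-dec R? (dec a s) (dec b t)
        where
        Goal : (Fin n → Fin 3) → (Fin n → Fin 3) → Set
        Goal s t = IsCrossHom S (enc a) (enc b) s t → R (dec a s) (dec b t)
        respᵗ : ∀ s {t t′} → t ≗ t′ → Goal s t → Goal s t′
        respᵗ s t≗t′ f h = subst (R (dec a s)) (dec-cong b t≗t′)
                                 (f (IsCrossHom-cong (λ _ → refl) (sym ∘ t≗t′) h))
        respˢ : ∀ {s s′} → s ≗ s′ → (∀ t → Goal s t) → ∀ t → Goal s′ t
        respˢ {s} {s′} s≗s′ f t h = subst (λ c → R c (dec b t)) (dec-cong a s≗s′)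
                                          (f t (IsCrossHom-cong (sym ∘ s≗s′) (λ _ → refl) h))

module Interpretation
  {S T : Str} (_≟ₛ_ : DecidableEquality (V S)) (E? : Decidable (E S))
  {A : Set} (codes : List A) (codes-complete : ∀ a → a ∈ codes) (code : V T → A)
  {d : ℕ} (enc : A → Fin (suc d) → V S) (dec : A → (Fin (suc d) → Fin 3) → Fin 3)
  (dec-cong : ∀ a {s s′} → s ≗ s′ → dec a s ≡ dec a s′)
  (edge-forced : ∀ x y → E T x y → Forcing.ForcedApart S enc dec (code x) (code y))
  where

  open Forcing S enc dec

  decideForced : ∀ {R} → Decidable R → ∀ a b → Dec (Forced R a b)
  decideForced = forced? dec-cong _≟ₛ_ E?

  module Translation (k : ℕ) (v₀ : Fin (suc d * k)) where
    open Connectives v₀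
    open Diagrams _≟ₛ_ E? v₀

    var : Fin k → Fin (suc d) → Fin (suc d * k)
    var i t = combine t i

    var-outside : ∀ {i j} → j ≢ i → ∀ t → Outside (var i) (var j t)
    var-outside j≢i t t′ e = j≢i (combine-injectiveʳ t _ t′ _ e)

    block : Fin (suc d * k) → Fin k
    block = remainder {suc d} k

    position : Fin (suc d * k) → Fin (suc d)
    position = quotient {suc d} k

    outside-block : ∀ {i x} → Outside (var i) x → block x ≢ i
    outside-block {x = x} out refl = out (position x) (sym (combine-remQuot {suc d} k x))

    encodeAll : (Fin k → A) → Fin (suc d * k) → V S
    encodeAll τ x = enc (τ (block x)) (position x)

    encodeAll-var : ∀ τ i t → encodeAll τ (var i t) ≡ enc (τ i) t
    encodeAll-var τ i t = cong (λ (t′ , i′) → enc (τ i′) t′) (remQuot-combine {suc d} {k} t i)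

    decodeAll : (Fin k → A) → (Fin (suc d * k) → Fin 3) → Fin k → Fin 3
    decodeAll τ σ j = dec (τ j) (σ ∘ var j)


    atomic : ∀ {R : Fin 3 → Fin 3 → Set} → Decidable R →
             Fin k → Fin k → (Fin k → A) → Formula (suc d * k)
    atomic R? i j τ = decideForced R? (τ i) (τ j)
                        ∧ᶠ crossDiagram (enc (τ i)) (enc (τ j)) (var i) (var j)

    translate : Formula k → (Fin k → A) → Formula (suc d * k)
    translate (adj i j) τ = atomic (λ c c′ → ¬? (c ≟ c′)) i j τ
    translate (eq i j)  τ = atomic _≟_ i j τ
    translate (φ ∧ ψ)   τ = translate φ τ ∧ translate ψ τ
    translate (φ ∨ ψ)   τ = translate φ τ ∨ translate ψ τ
    translate (ex i φ)  τ = ⋁ codes λ a → exAll (var i) (translate φ (update τ i a))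

    InFreeBlock : Fin (suc d * k) → Formula k → Set
    InFreeBlock x φ = Σ[ j ∈ Fin k ] Σ[ t ∈ Fin (suc d) ] x ≡ var j t × Free j φ

    inFreeBlock-map : ∀ {x φ ψ} → (∀ {j} → Free j φ → Free j ψ) → InFreeBlock x φ → InFreeBlock x ψ
    inFreeBlock-map f (j , t , x≡ , h) = j , t , x≡ , f h

    module _ {R : Fin 3 → Fin 3 → Set} (R? : Decidable R) (i j : Fin k) (τ : Fin k → A) where

      atomic-free : ∀ {x} → Free x (atomic R? i j τ) → InFreeBlock x (eq i j)
      atomic-free h with crossDiagram-free _ _ _ _ (∧ᶠ-free (decideForced R? (τ i) (τ j)) h)
      ... | inj₁ (t , x≡) = i , t , x≡ , inj₁ refl
      ... | inj₂ (t , x≡) = j , t , x≡ , inj₂ refl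

      atomic-sound : Forced R (τ i) (τ j) → ⟦ atomic R? i j τ ⟧ S (encodeAll τ)
      atomic-sound forced =
        ∧ᶠ-intro (decideForced R? (τ i) (τ j)) S forced
          (crossDiagram-holds _ _ _ _ (encodeAll-var τ i) (encodeAll-var τ j))

      atomic-complete : ∀ σ → ⟦ atomic R? i j τ ⟧ K3 σ → R (decodeAll τ σ i) (decodeAll τ σ j)
      atomic-complete σ h with ∧ᶠ-elim (decideForced R? (τ i) (τ j)) h
      ... | forced , diagram = forced (σ ∘ var i) (σ ∘ var j) (crossDiagram-K3 _ _ _ _ diagram)

    translate-free : ∀ φ τ {x} → Free x (translate φ τ) → InFreeBlock x φ
    translate-free (adj i j) τ h        = atomic-free _ i j τ h
    translate-free (eq i j)  τ h        = atomic-free _ i j τ h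
    translate-free (φ ∧ ψ)   τ (inj₁ h) = inFreeBlock-map {ψ = φ ∧ ψ} inj₁ (translate-free φ τ h)
    translate-free (φ ∧ ψ)   τ (inj₂ h) = inFreeBlock-map {ψ = φ ∧ ψ} inj₂ (translate-free ψ τ h)
    translate-free (φ ∨ ψ)   τ (inj₁ h) = inFreeBlock-map {ψ = φ ∨ ψ} inj₁ (translate-free φ τ h)
    translate-free (φ ∨ ψ)   τ (inj₂ h) = inFreeBlock-map {ψ = φ ∨ ψ} inj₂ (translate-free ψ τ h)
    translate-free (ex i φ)  τ h with ⋁-free codes h
    ... | a , h′ with exAll-free (var i) _ h′
    ...   | out , h″ with translate-free φ (update τ i a) h″
    ...     | j , t , refl , free = j , t , refl , (λ { refl → out t refl }) , free

    translate-closed : ∀ φ τ → Sentence φ → Sentence (translate φ τ)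
    translate-closed φ τ closed x h with translate-free φ τ h
    ... | j , _ , _ , free = closed j free

    translate-sound : ∀ φ {τ ρ} → (∀ j → τ j ≡ code (ρ j)) →
                      ⟦ φ ⟧ T ρ → ⟦ translate φ τ ⟧ S (encodeAll τ)
    translate-sound (adj i j) {τ} τ≡ h =
      atomic-sound _ i j τ (subst₂ ForcedApart (sym (τ≡ i)) (sym (τ≡ j)) (edge-forced _ _ h))
    translate-sound (eq i j)  {τ} τ≡ h =
      atomic-sound _ i j τ (subst (ForcedEqual (τ i)) (trans (τ≡ i) (trans (cong code h) (sym (τ≡ j))))
                                  (forcedEqual-refl dec-cong (τ i)))
    translate-sound (φ ∧ ψ) τ≡ (h , h′) = translate-sound φ τ≡ h , translate-sound ψ τ≡ h′
    translate-sound (φ ∨ ψ) τ≡ h = Sum.map (translate-sound φ τ≡) (translate-sound ψ τ≡) h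
    translate-sound (ex i φ) {τ} τ≡ (a , h) =
      ⋁-intro S (codes-complete (code a))
        (exAll-intro (var i) _ S agree (translate-sound φ (update-natural code i a τ≡) h))
      where
      agree : ∀ x → Outside (var i) x → encodeAll (update τ i (code a)) x ≡ encodeAll τ x
      agree x out = cong (λ b → enc b (position x)) (update-other τ (code a) (outside-block out))

    translate-complete : ∀ φ τ σ → ⟦ translate φ τ ⟧ K3 σ → ⟦ φ ⟧ K3 (decodeAll τ σ)
    translate-complete (adj i j) τ σ h = atomic-complete _ i j τ σ h
    translate-complete (eq i j)  τ σ h = atomic-complete _ i j τ σ h
    translate-complete (φ ∧ ψ) τ σ (h , h′) = translate-complete φ τ σ h , translate-complete ψ τ σ h′
    translate-complete (φ ∨ ψ) τ σ h = Sum.map (translate-complete φ τ σ) (translate-complete ψ τ σ) h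
    translate-complete (ex i φ) τ σ h with ⋁-elim codes h
    ... | a , h′ with exAll-elim (var i) _ K3 h′
    ...   | σ′ , agree , h″ =
      dec a (σ′ ∘ var i) , ⟦⟧-cong φ K3 decoded (translate-complete φ (update τ i a) σ′ h″)
      where
      decoded : decodeAll (update τ i a) σ′ ≗ update (decodeAll τ σ) i (dec a (σ′ ∘ var i))
      decoded j with j ≟ i
      ... | yes refl = refl
      ... | no  j≢i  = dec-cong (τ j) (λ t → agree (var j t) (var-outside j≢i t))

    width-reduces : WGt S (suc d * k) → WGt T k
    width-reduces W φ closed (ρ , h) =
      decode (W (translate φ τ) (translate-closed φ τ closed)
                (encodeAll τ , translate-sound φ (λ _ → refl) h))
      where
      τ = code ∘ ρ
      decode : K3 ⊨ translate φ τ → K3 ⊨ φ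
      decode (σ , h′) = decodeAll τ σ , translate-complete φ τ σ h′

  width-reduction : ∀ k → WGt S (suc d * k) → WGt T k
  width-reduction zero    _ φ = ⊥-elim (no-formula₀ φ)
  width-reduction (suc k)     = Translation.width-reduces (suc k) (combine {suc d} {suc k} zero zero)

data Hor : CV → Set where
  east : Hor a[2,0]
  west : Hor a[-2,0]

data Ver : CV → Set where
  north : Ver a[0,2]
  south : Ver a[0,-2]

Corner : CV → Set
Corner x = Hor x ⊎ Ver x

hor≢ver : ∀ {x} → Hor x → ¬ Ver x
hor≢ver east ()
hor≢ver west ()

inner-endpoint : ∀ {x y} → CEdge x y → ¬ Corner x ⊎ ¬ Corner y
inner-endpoint c1  = inj₁ [ (λ ()) , (λ ()) ]
inner-endpoint c2  = inj₁ [ (λ ()) , (λ ()) ]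
inner-endpoint c3  = inj₁ [ (λ ()) , (λ ()) ]
inner-endpoint c4  = inj₁ [ (λ ()) , (λ ()) ]
inner-endpoint c5  = inj₁ [ (λ ()) , (λ ()) ]
inner-endpoint c6  = inj₁ [ (λ ()) , (λ ()) ]
inner-endpoint c7  = inj₁ [ (λ ()) , (λ ()) ]
inner-endpoint c8  = inj₁ [ (λ ()) , (λ ()) ]
inner-endpoint c9  = inj₁ [ (λ ()) , (λ ()) ]
inner-endpoint c10 = inj₁ [ (λ ()) , (λ ()) ]
inner-endpoint c11 = inj₁ [ (λ ()) , (λ ()) ]
inner-endpoint c12 = inj₁ [ (λ ()) , (λ ()) ]
inner-endpoint c13 = inj₁ [ (λ ()) , (λ ()) ]
inner-endpoint c14 = inj₁ [ (λ ()) , (λ ()) ]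
inner-endpoint c15 = inj₁ [ (λ ()) , (λ ()) ]
inner-endpoint c16 = inj₁ [ (λ ()) , (λ ()) ]
inner-endpoint c17 = inj₁ [ (λ ()) , (λ ()) ]
inner-endpoint c18 = inj₁ [ (λ ()) , (λ ()) ]
inner-endpoint c19 = inj₂ [ (λ ()) , (λ ()) ]
inner-endpoint c20 = inj₂ [ (λ ()) , (λ ()) ]
inner-endpoint c21 = inj₂ [ (λ ()) , (λ ()) ]
inner-endpoint c22 = inj₂ [ (λ ()) , (λ ()) ]
inner-endpoint c23 = inj₂ [ (λ ()) , (λ ()) ]
inner-endpoint c24 = inj₂ [ (λ ()) , (λ ()) ]

allCV : List CV
allCV = a[0,0] ∷ a[1,0] ∷ a[2,0] ∷ a[-1,0] ∷ a[-2,0] ∷ a[0,1] ∷ a[0,-1] ∷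
        a[1,1] ∷ a[-1,1] ∷ a[1,-1] ∷ a[-1,-1] ∷ a[0,2] ∷ a[0,-2] ∷ []

∈-allCV : ∀ x → x ∈ allCV
∈-allCV a[0,0]   = here refl
∈-allCV a[1,0]   = there (here refl)
∈-allCV a[2,0]   = there (there (here refl))
∈-allCV a[-1,0]  = there (there (there (here refl)))
∈-allCV a[-2,0]  = there (there (there (there (here refl))))
∈-allCV a[0,1]   = there (there (there (there (there (here refl)))))
∈-allCV a[0,-1]  = there (there (there (there (there (there (here refl))))))
∈-allCV a[1,1]   = there (there (there (there (there (there (there (here refl)))))))
∈-allCV a[-1,1]  = there (there (there (there (there (there (there (there (here refl))))))))
∈-allCV a[1,-1]  = there (there (there (there (there (there (there (there (there (here refl)))))))))
∈-allCV a[-1,-1] = there (there (there (there (there (there (there (there (there (there (here refl))))))))))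
∈-allCV a[0,2]   = there (there (there (there (there (there (there (there (there (there (there (here refl)))))))))))
∈-allCV a[0,-2]  = there (there (there (there (there (there (there (there (there (there (there (there (here refl))))))))))))

Proper : (CV → Fin 3) → Set
Proper κ = ∀ {x y} → CEdge x y → κ x ≢ κ y

cornersEqual : CV → Fin 3
cornersEqual a[0,0]   = 0F
cornersEqual a[1,0]   = 1F
cornersEqual a[2,0]   = 0F
cornersEqual a[-1,0]  = 1F
cornersEqual a[-2,0]  = 0F
cornersEqual a[0,1]   = 2F
cornersEqual a[0,-1]  = 2F
cornersEqual a[1,1]   = 2F
cornersEqual a[-1,1]  = 1F
cornersEqual a[1,-1]  = 1F
cornersEqual a[-1,-1] = 2F
cornersEqual a[0,2]   = 0F
cornersEqual a[0,-2]  = 0F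

cornersApart : CV → Fin 3
cornersApart a[0,0]   = 2F
cornersApart a[1,0]   = 1F
cornersApart a[2,0]   = 0F
cornersApart a[-1,0]  = 1F
cornersApart a[-2,0]  = 0F
cornersApart a[0,1]   = 0F
cornersApart a[0,-1]  = 0F
cornersApart a[1,1]   = 2F
cornersApart a[-1,1]  = 2F
cornersApart a[1,-1]  = 2F
cornersApart a[-1,-1] = 2F
cornersApart a[0,2]   = 1F
cornersApart a[0,-2]  = 1F

cornersEqual-proper : Proper cornersEqual
cornersEqual-proper c1  ()
cornersEqual-proper c2  ()
cornersEqual-proper c3  ()
cornersEqual-proper c4  ()
cornersEqual-proper c5  ()
cornersEqual-proper c6  ()
cornersEqual-proper c7  ()
cornersEqual-proper c8  ()
cornersEqual-proper c9  ()
cornersEqual-proper c10 ()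
cornersEqual-proper c11 ()
cornersEqual-proper c12 ()
cornersEqual-proper c13 ()
cornersEqual-proper c14 ()
cornersEqual-proper c15 ()
cornersEqual-proper c16 ()
cornersEqual-proper c17 ()
cornersEqual-proper c18 ()
cornersEqual-proper c19 ()
cornersEqual-proper c20 ()
cornersEqual-proper c21 ()
cornersEqual-proper c22 ()
cornersEqual-proper c23 ()
cornersEqual-proper c24 ()

cornersApart-proper : Proper cornersApart
cornersApart-proper c1  ()
cornersApart-proper c2  ()
cornersApart-proper c3  ()
cornersApart-proper c4  ()
cornersApart-proper c5  ()
cornersApart-proper c6  ()
cornersApart-proper c7  ()
cornersApart-proper c8  ()
cornersApart-proper c9  ()
cornersApart-proper c10 ()
cornersApart-proper c11 ()
cornersApart-proper c12 ()
cornersApart-proper c13 ()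
cornersApart-proper c14 ()
cornersApart-proper c15 ()
cornersApart-proper c16 ()
cornersApart-proper c17 ()
cornersApart-proper c18 ()
cornersApart-proper c19 ()
cornersApart-proper c20 ()
cornersApart-proper c21 ()
cornersApart-proper c22 ()
cornersApart-proper c23 ()
cornersApart-proper c24 ()

permute-proper : ∀ (π : Permutation′ 3) {κ} → Proper κ → Proper ((π ⟨$⟩ʳ_) ∘ κ)
permute-proper π proper e πκx≡πκy =
  proper e (trans (sym (inverseˡ π)) (trans (cong (π ⟨$⟩ˡ_) πκx≡πκy) (inverseˡ π)))

-- Up to a renaming of colours sending 0 to h (and 1 to w when h ≢ w), every colouring of the
-- corners with opposite corners equal is that of cornersEqual or of cornersApart.
gadgetColouring : Fin 3 → Fin 3 → CV → Fin 3
gadgetColouring h w with h ≟ w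
... | yes _   = (insert 0F h id ⟨$⟩ʳ_) ∘ cornersEqual
... | no  h≢w = (insert 0F h (transpose 0F (punchOut h≢w)) ⟨$⟩ʳ_) ∘ cornersApart

gadgetColouring-proper : ∀ h w → Proper (gadgetColouring h w)
gadgetColouring-proper h w with h ≟ w
... | yes _   = permute-proper (insert 0F h id) cornersEqual-proper
... | no  h≢w = permute-proper (insert 0F h (transpose 0F (punchOut h≢w))) cornersApart-proper

gadgetColouring-hor : ∀ h w {x} → Hor x → gadgetColouring h w x ≡ h
gadgetColouring-hor h w x with h ≟ w
gadgetColouring-hor h w east | yes _ = refl
gadgetColouring-hor h w west | yes _ = refl
gadgetColouring-hor h w east | no  _ = refl
gadgetColouring-hor h w west | no  _ = refl

gadgetColouring-ver : ∀ h w {x} → Ver x → gadgetColouring h w x ≡ w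
gadgetColouring-ver h w x with h ≟ w
gadgetColouring-ver h w north | yes h≡w = h≡w
gadgetColouring-ver h w south | yes h≡w = h≡w
gadgetColouring-ver h w north | no  h≢w = punchIn-punchOut h≢w
gadgetColouring-ver h w south | no  h≢w = punchIn-punchOut h≢w

module CrossingEncoding (G : Graph) (D : Drawing G) where
  open Construction G D
  open Drawing D

  adj? : Decidable (Adj G)
  adj? x y = any? λ e → ((src G e ≟ x) ×-dec (tgt G e ≟ y)) ⊎-dec ((src G e ≟ y) ×-dec (tgt G e ≟ x))

  adj-sym : Symmetric (Adj G)
  adj-sym (e , ends) = e , Sum.swap ends

  preVertices : List V₀
  preVertices = map inj₁ (allFin (n G)) ++ map inj₂ (cartesianProduct (allFin c) allCV)

  ∈-preVertices : ∀ a → a ∈ preVertices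
  ∈-preVertices (inj₁ u)       = ∈-++⁺ˡ (∈-map⁺ inj₁ (∈-allFin u))
  ∈-preVertices (inj₂ (p , x)) =
    ∈-++⁺ʳ (map inj₁ (allFin (n G))) (∈-map⁺ inj₂ (∈-cartesianProduct⁺ (∈-allFin p) (∈-allCV x)))

  endpoints : Fin c → Fin 4 → Fin (n G)
  endpoints p 0F = src G (e₁ p)
  endpoints p 1F = tgt G (e₁ p)
  endpoints p 2F = src G (e₂ p)
  endpoints p 3F = tgt G (e₂ p)

  encode : V₀ → Fin 4 → Fin (n G)
  encode (inj₁ u)       _ = u
  encode (inj₂ (p , _))   = endpoints p

  decode : V₀ → (Fin 4 → Fin 3) → Fin 3
  decode (inj₁ _)       s = s 0F
  decode (inj₂ (_ , x)) s = gadgetColouring (s 0F) (s 2F) x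

  decode-cong : ∀ a {s s′} → s ≗ s′ → decode a s ≡ decode a s′
  decode-cong (inj₁ _)       s≗s′ = s≗s′ 0F
  decode-cong (inj₂ (_ , x)) s≗s′ = cong₂ (λ h w → gadgetColouring h w x) (s≗s′ 0F) (s≗s′ 2F)

  open Forcing (toStr G) encode decode

  AlongCorner : Fin c → Fin (m G) → CV → Set
  AlongCorner p e x = (e ≡ e₁ p × Hor x) ⊎ (e ≡ e₂ p × Ver x)

  srcCorner-along : ∀ {p e x} → SrcCorner p e x → AlongCorner p e x
  srcCorner-along {p} (inj₁ (e≡ , refl)) = inj₁ (e≡ , both-branches Hor (flip₁ p) east west)
  srcCorner-along {p} (inj₂ (e≡ , refl)) = inj₂ (e≡ , both-branches Ver (flip₂ p) north south)

  tgtCorner-along : ∀ {p e x} → TgtCorner p e x → AlongCorner p e x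
  tgtCorner-along {p} (inj₁ (e≡ , refl)) = inj₁ (e≡ , both-branches Hor (flip₁ p) west east)
  tgtCorner-along {p} (inj₂ (e≡ , refl)) = inj₂ (e≡ , both-branches Ver (flip₂ p) south north)

  along-corner : ∀ {p e x} → AlongCorner p e x → Corner x
  along-corner = Sum.map proj₂ proj₂

  sourceSlot : ∀ {p e x} → AlongCorner p e x →
               Σ[ t ∈ Fin 4 ] endpoints p t ≡ src G e × (∀ s → decode (inj₂ (p , x)) s ≡ s t)
  sourceSlot (inj₁ (refl , hx)) = 0F , refl , λ s → gadgetColouring-hor (s 0F) (s 2F) hx
  sourceSlot (inj₂ (refl , vx)) = 2F , refl , λ s → gadgetColouring-ver (s 0F) (s 2F) vx

  srcCorner-not-tgtCorner : ∀ {p e e′ x} → SrcCorner p e x → ¬ TgtCorner p e′ x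
  srcCorner-not-tgtCorner {p} (inj₁ (_ , x≡)) (inj₁ (_ , x≡′)) =
    if-swap-≢ (flip₁ p) (λ ()) (trans (sym x≡) x≡′)
  srcCorner-not-tgtCorner {p} (inj₂ (_ , x≡)) (inj₂ (_ , x≡′)) =
    if-swap-≢ (flip₂ p) (λ ()) (trans (sym x≡) x≡′)
  srcCorner-not-tgtCorner {p} (inj₁ (_ , x≡)) (inj₂ (_ , x≡′)) =
    hor≢ver (subst Hor (sym x≡) (both-branches Hor (flip₁ p) east west))
            (subst Ver (sym x≡′) (both-branches Ver (flip₂ p) south north))
  srcCorner-not-tgtCorner {p} (inj₂ (_ , x≡)) (inj₁ (_ , x≡′)) =
    hor≢ver (subst Hor (sym x≡′) (both-branches Hor (flip₁ p) west east))
            (subst Ver (sym x≡) (both-branches Ver (flip₂ p) north south))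

  ident-srcCorner : ∀ {p x b} → Ident (inj₂ (p , x)) b → Σ[ e ∈ Fin (m G) ] SrcCorner p e x
  ident-srcCorner (first e _ _ _ _ sc)      = e , sc
  ident-srcCorner (next e _ _ _ _ _ _ _ _ sc) = e , sc

  canonical-self : ∀ {a₀ a} → (∀ {b} → ¬ Ident a₀ b) → Canon a₀ a → a ≡ a₀
  canonical-self _        (inj₁ (_ , refl)) = refl
  canonical-self ¬ident   (inj₂ ident)      = ⊥-elim (¬ident ident)

  canonical-vertex : ∀ {u a} → Canon (inj₁ u) a → a ≡ inj₁ u
  canonical-vertex = canonical-self λ ()

  canonical-inner : ∀ {p x a} → ¬ Corner x → Canon (inj₂ (p , x)) a → a ≡ inj₂ (p , x)
  canonical-inner x-inner = canonical-self λ ident →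
    x-inner (along-corner (srcCorner-along (proj₂ (ident-srcCorner ident))))

  canonical-tgtCorner : ∀ {p e y a} → TgtCorner p e y → Canon (inj₂ (p , y)) a → a ≡ inj₂ (p , y)
  canonical-tgtCorner tc = canonical-self λ ident →
    srcCorner-not-tgtCorner (proj₂ (ident-srcCorner ident)) tc

  -- Identified vertices carry the colour of the source of the edge they lie on.
  canonical-decode : ∀ {a₀ a s s₀} → Canon a₀ a →
                     (∀ t t₀ → encode a t ≡ encode a₀ t₀ → s t ≡ s₀ t₀) →
                     decode a s ≡ decode a₀ s₀
  canonical-decode {a₀} (inj₁ (_ , refl)) agree = decode-cong a₀ λ t → agree t t refl
  canonical-decode {s₀ = s₀} (inj₂ (first _ _ _ _ _ sc)) agree
    with sourceSlot (srcCorner-along sc)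
  ... | t₀ , src≡ , reads = trans (agree 0F t₀ (sym src≡)) (sym (reads s₀))
  canonical-decode {s = s} {s₀} (inj₂ (next _ _ _ _ _ _ _ _ tc sc)) agree
    with sourceSlot (tgtCorner-along tc) | sourceSlot (srcCorner-along sc)
  ... | t , src≡ , reads | t₀ , src≡₀ , reads₀ =
    trans (reads s) (trans (agree t t₀ (trans src≡ (sym src≡₀))) (sym (reads₀ s₀)))

  gadgetEdge-forcedApart : ∀ {p x y a b} → (∀ h w → gadgetColouring h w x ≢ gadgetColouring h w y) →
                           ¬ Corner x → Canon (inj₂ (p , x)) a → Canon (inj₂ (p , y)) b → ForcedApart a b
  gadgetEdge-forcedApart apart x-inner ca cb with canonical-inner x-inner ca
  ... | refl = λ s t h s≡t →
    apart (s 0F) (s 2F) (trans s≡t (canonical-decode cb λ q q₀ e → sym (consistent h q₀ q (sym e))))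

  baseEdge-forcedApart : ∀ {a₀ b₀ a b} → BaseE a₀ b₀ → Canon a₀ a → Canon b₀ b → ForcedApart a b
  baseEdge-forcedApart (keep e _) ca cb with canonical-vertex ca | canonical-vertex cb
  ... | refl | refl = λ s t h → separating h 0F 0F (e , inj₁ (refl , refl))
  baseEdge-forcedApart (last e _ p y _ tc) ca cb with canonical-tgtCorner tc ca | canonical-vertex cb
  ... | refl | refl with sourceSlot (tgtCorner-along tc)
  ...   | t₀ , src≡ , reads = λ s t h s≡t →
    separating h t₀ 0F (subst (λ u → Adj G u (tgt G e)) (sym src≡) (e , inj₁ (refl , refl)))
               (trans (sym (reads s)) s≡t)
  baseEdge-forcedApart {a = a} {b} (gadget p x y xy) ca cb with inner-endpoint xy
  ... | inj₁ x-inner = gadgetEdge-forcedApart (λ h w → gadgetColouring-proper h w xy) x-inner ca cb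
  ... | inj₂ y-inner = forcedApart-sym adj-sym {b} {a}
        (gadgetEdge-forcedApart (λ h w → gadgetColouring-proper h w xy ∘ sym) y-inner cb ca)

  edge-forcedApart : ∀ x y → E G' x y → ForcedApart (proj₁ x) (proj₁ y)
  edge-forcedApart _ _ (_ , _ , base , inj₁ (ca , cb)) = baseEdge-forcedApart base ca cb
  edge-forcedApart x y (_ , _ , base , inj₂ (cb , ca)) =
    forcedApart-sym adj-sym {proj₁ y} {proj₁ x} (baseEdge-forcedApart base ca cb)

lemma7 : (G : Graph) → (D : Drawing G) → ChiGt3 G → (k : ℕ) →
    WGt (toStr G) (4 * k) → WGt (G'-of G D) k
lemma7 G D _ = Interpretation.width-reduction _≟_ adj? preVertices ∈-preVertices proj₁
                 encode decode decode-cong edge-forcedApart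
  where open CrossingEncoding G D
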